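{- Let $\mathcal H$ be a finite multi-sorted relational structure and $p$ a prime. Then, up to isomorphism, there exists a unique $p$-rigid multi-sorted structure $\mathcal H^{*p}$ such that $\mathcal H\rightarrow_p^*\mathcal H^{*p}$.
   Context: A multi-sorted structure $\mathcal H$ has base set a family $\{H_i\}_{i\in[k]}$ of pairwise disjoint finite sets, and each relational symbol $\mathcal R$ of its signature has a type $(i_1,\dots,i_\ell)$ and is interpreted as a relation $\mathcal R^{\mathcal H}\subseteq H_{i_1}\times\dots\times H_{i_\ell}$. Similar structures have the same signature and types. A homomorphism $\varphi=\{\varphi_i\}_{i\in[k]}$, $\varphi_i:G_i\to H_i$, maps every tuple of $\mathcal R^{\mathcal G}$ (coordinatewise, using $\varphi_{i_j}$ in coordinate $j$) into $\mathcal R^{\mathcal H}$; isomorphisms and automorphisms are defined as usual, with each component bijective. An automorphism $\pi=\{\pi_i\}$ has order $p$ if each $\pi_i$ is either the identity or has order $p$, and at least one $\pi_i$ is not the identity. $\mathcal H$ is $p$-rigid if it has no automorphism of order $p$. For an automorphism $\pi$, $\mathcal H^\pi$ is the substructure of $\mathcal H$ induced by the sets $\mathsf{Fix}(\pi_i)=\{a\in H_i:\pi_i(a)=a\}$ (each relation intersected with the product of these sets). Write $\mathcal H\rightarrow_p\mathcal H'$ if there is an automorphism $\pi$ of $\mathcal H$ of order $p$ with $\mathcal H'\cong\mathcal H^\pi$, and $\mathcal H\rightarrow_p^*\mathcal H'$ if there are structures $\mathcal H_1,\dots,\mathcal H_t$ with $\mathcal H\cong\mathcal H_1\rightarrow_p\mathcal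 H_2\rightarrow_p\cdots\rightarrow_p\mathcal H_t\cong\mathcal H'$ (allowing $t=1$). -}

module Defs where

open import Data.Nat using (ℕ; zero; suc; _<_)
open import Data.Fin using (Fin)
open import Data.Bool using (Bool)
open import Data.List using (List; []; _∷_)
open import Data.Unit using (⊤; tt)
open import Data.Empty using (⊥)
open import Data.Product using (Σ; _×_; _,_; proj₁)
open import Data.Sum using (_⊎_)
open import Relation.Nullary using (¬_)
open import Relation.Binary.PropositionalEquality using (_≡_)
open import Function.Bundles using (_↔_; Inverse)
open import Data.Nat.Primality using (Prime)

record Signature : Set where
  field
    sorts : ℕ
    nsym  : ℕ
    type  : Fin nsym → List (Fin sorts)
open Signature public

Tuple : {k : ℕ} → (Fin k → ℕ) → List (Fin k) → Set
Tuple size []       = ⊤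
Tuple size (i ∷ is) = Fin (size i) × Tuple size is

mapTuple : {k : ℕ} {n m : Fin k → ℕ} →
           ((i : Fin k) → Fin (n i) → Fin (m i)) →
           (is : List (Fin k)) → Tuple n is → Tuple m is
mapTuple φ []       tt       = tt
mapTuple φ (i ∷ is) (a , t)  = φ i a , mapTuple φ is t

-- A finite multi-sorted structure: the i-th base set is Fin (size i)
-- (distinct sorts are disjoint by construction), and each relation R is a
-- (decidable, finite) subset of H_{i₁}×…×H_{iₗ}, given by its indicator.
record Structure (σ : Signature) : Set where
  field
    size : Fin (sorts σ) → ℕ
    rel  : (r : Fin (nsym σ)) → Tuple size (type σ r) → Bool
open Structure public

module _ {σ : Signature} where

  record Iso (G H : Structure σ) : Set where
    field
      bij  : (i : Fin (sorts σ)) → Fin (size G i) ↔ Fin (size H i)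
      pres : (r : Fin (nsym σ)) (t : Tuple (size G) (type σ r)) →
             rel G r t ≡ rel H r (mapTuple (λ i → Inverse.to (bij i)) (type σ r) t)

  Automorphism : Structure σ → Set
  Automorphism H = Iso H H

  iter : {A : Set} → (A → A) → ℕ → A → A
  iter f zero    a = a
  iter f (suc m) a = f (iter f m a)

  IsIdentity : {A : Set} → (A → A) → Set
  IsIdentity {A} f = (a : A) → f a ≡ a

  HasOrder : {A : Set} → ℕ → (A → A) → Set
  HasOrder p f = IsIdentity (iter f p) ×
                 ((m : ℕ) → 0 < m → m < p → ¬ IsIdentity (iter f m))

  component : {H : Structure σ} → Automorphism H →
              (i : Fin (sorts σ)) → Fin (size H i) → Fin (size H i)
  component π i = Inverse.to (Iso.bij π i)

  OrderP : ℕ → {H : Structure σ} → Automorphism H → Set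
  OrderP p π =
    ((i : Fin (sorts σ)) → IsIdentity (component π i) ⊎ HasOrder p (component π i)) ×
    Σ (Fin (sorts σ)) (λ i → ¬ IsIdentity (component π i))

  Rigid : ℕ → Structure σ → Set
  Rigid p H = ¬ Σ (Automorphism H) (OrderP p)

  Fix : {H : Structure σ} → Automorphism H → Fin (sorts σ) → Set
  Fix {H} π i = Σ (Fin (size H i)) (λ a → component π i a ≡ a)

  -- H' ≅ H^π, where H^π is the substructure induced on the sets Fix(π_i):
  -- bijections ψ_i : H'_i ↔ Fix(π_i) with R^{H'}(t) ⇔ R^H(ψ t).
  IsoFix : (H' : Structure σ) {H : Structure σ} → Automorphism H → Set
  IsoFix H' {H} π =
    Σ ((i : Fin (sorts σ)) → Fin (size H' i) ↔ Fix π i) λ ψ →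
      (r : Fin (nsym σ)) (t : Tuple (size H') (type σ r)) →
      rel H' r t ≡ rel H r (mapTuple (λ i a → proj₁ (Inverse.to (ψ i) a)) (type σ r) t)

  Step : ℕ → Structure σ → Structure σ → Set
  Step p H H' = Σ (Automorphism H) λ π → OrderP p π × IsoFix H' π

  data Steps (p : ℕ) : Structure σ → Structure σ → Set where
    done : {H₁ H' : Structure σ} → Iso H₁ H' → Steps p H₁ H'
    step : {H₁ H₂ H' : Structure σ} → Step p H₁ H₂ → Steps p H₂ H' → Steps p H₁ H'

  -- H →_p^* H' : H ≅ H₁ →_p ⋯ →_p H_t ≅ H'  (t = 1 allowed)
  Reach : ℕ → Structure σ → Structure σ → Set
  Reach p H H' = Σ (Structure σ) λ H₁ → Iso H H₁ × Steps p H₁ H'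

-- For finite structures J and H let e(J, H) be the number of strong embeddings
-- J → H. If π is an automorphism of H of order p, composing with π is an action
-- of order p on these embeddings whose fixed points are exactly the embeddings
-- into H^π; hence e(J, H) ≡ e(J, H^π) mod p, and e(J, -) mod p is invariant
-- along →ₚ*. Existence: H^π is strictly smaller than H, so repeatedly passing to
-- fixed points ends at a p-rigid structure. Uniqueness: if H₁ and H₂ are p-rigid
-- and both reachable from H, then e(H₁, H₂) ≡ e(H₁, H₁) = |Aut H₁| mod p, which
-- is not divisible by p by Cauchy's theorem; so H₁ embeds into H₂, symmetrically
-- H₂ embeds into H₁, and mutual embeddings of finite structures are isomorphisms.

module Submission where

open import Defs
open import Axiom.UniquenessOfIdentityProofs using (module Decidable⇒UIP)
open import Data.Bool using (Bool; true; false; T; _∧_; not)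
open import Data.Bool.Properties using (T-irrelevant; T-∧)
import Data.Bool.Properties as Bool
open import Data.Empty using (⊥-elim)
open import Data.Fin using (Fin; zero; suc; toℕ; fromℕ<; punchOut)
open import Data.Fin.Permutation using (↔⇒≡)
open import Data.Fin.Properties using (+↔⊎; *↔×; 1↔⊤; all?; any?; toℕ-fromℕ<; toℕ-injective; toℕ<n; punchOut-injective; injective⇒≤; ¬∀⟶∃¬; cantor-schröder-bernstein)
import Data.Fin.Properties as Fin
open import Data.List using (List; []; _∷_; _++_; [_]; length)
open import Data.List.Properties using (++-assoc; ++-identityʳ)
open import Data.Nat using (ℕ; zero; suc; _+_; _*_; _^_; _<_; _≤_; z≤n; s≤s; _∸_; _%_; _/_; NonZero; >-nonZero⁻¹; >-nonZero; nonTrivial⇒n>1; s<s⁻¹)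
open import Data.Nat.Coprimality using (prime⇒coprime; coprime-Bézout)
open import Data.Nat.DivMod using (m≡m%n+[m/n]*n; [m+kn]%n≡m%n; m%n<n; m*n%n≡0)
open import Data.Nat.Divisibility using (divides; _∣_; _∣0; ∣-refl; ∣m∣n⇒∣m+n; m%n≡0⇒n∣m; ∣-trans; m∣m*n; ∣⇒≤; n∣m⇒m%n≡0)
open import Data.Nat.GCD using (module Bézout)
open import Data.Nat.GeneralisedArithmetic using (fold; fold-+)
open import Data.Nat.Induction using (<-rec; <-wellFounded)
open import Data.Nat.Primality using (Prime; prime⇒nonZero; prime⇒nonTrivial)
open import Data.Nat.Properties using (+-suc; <-trans; m≤m+n; m<m+n; +-comm; suc-pred; m<n⇒0<n∸m; m∸n≤m; ≤-<-trans; m+[n∸m]≡n; <⇒≤; <-cmp; m<n+m; <-≤-trans; <-irrefl; ≤-trans; ≤-refl; ≤-reflexive; +-mono-≤; +-mono-<-≤; +-mono-≤-<; n≢0⇒n>0)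
open import Data.Product using (Σ; _×_; _,_; proj₁; proj₂)
open import Data.Product.Function.NonDependent.Propositional using (_×-↔_)
open import Data.Sum using (_⊎_; inj₁; inj₂; [_,_]′)
open import Data.Sum.Function.Propositional using (_⊎-↔_)
open import Data.Unit using (⊤; tt)
open import Data.Vec using (Vec; []; _∷_; _∷ʳ_; replicate; toList; lookup; tabulate)
open import Data.Vec.Properties using (∷-injective; toList-∷ʳ; toList-injective; cast-is-id; length-toList; lookup∘tabulate; tabulate∘lookup; tabulate-cong)
open import Function.Base using (_∘_)
open import Function.Bundles using (_↔_; _⇔_; Inverse; Injection; mk↔ₛ′; mk⇔; Equivalence)
open import Function.Properties.Inverse using (↔-sym; ↔-trans; ↔-refl; ↔⇒↣)
open import Induction.WellFounded using (Acc; acc)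
open import Relation.Binary.Definitions using (DecidableEquality; tri<; tri≈; tri>)
open import Relation.Binary.PropositionalEquality hiding ([_])
open import Relation.Nullary using (¬_; Dec; yes; no)
open import Relation.Nullary.Decidable using (map′; isYes; isYes≗does; does-⇔; toWitness; fromWitness; _×-dec_; ¬?)

module _ {A B : Set} (e : A ↔ B) where

  to-injective : ∀ {x y} → Inverse.to e x ≡ Inverse.to e y → x ≡ y
  to-injective = Injection.injective (↔⇒↣ e)

  from-injective : ∀ {x y} → Inverse.from e x ≡ Inverse.from e y → x ≡ y
  from-injective = Injection.injective (↔⇒↣ (↔-sym e))

Σ-≡-irrelevant : {A : Set} {P : A → Set} → (∀ {a} (u v : P a) → u ≡ v) →
                 {x y : Σ A P} → proj₁ x ≡ proj₁ y → x ≡ y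
Σ-≡-irrelevant irr {_ , u} {_ , v} refl = cong (_ ,_) (irr u v)

Fin-≡-irrelevant : ∀ {n} {a b : Fin n} (u v : a ≡ b) → u ≡ v
Fin-≡-irrelevant = Decidable⇒UIP.≡-irrelevant Fin._≟_

isYes-⇔ : {A B : Set} → A ⇔ B → (a? : Dec A) (b? : Dec B) → isYes a? ≡ isYes b?
isYes-⇔ A⇔B a? b? = trans (isYes≗does a?) (trans (does-⇔ A⇔B a? b?) (sym (isYes≗does b?)))

∧-redundantˡ : ∀ {a b} → (T b → T a) → a ∧ b ≡ b
∧-redundantˡ {true}          _   = refl
∧-redundantˡ {false} {false} _   = refl
∧-redundantˡ {false} {true}  b⇒a = ⊥-elim (b⇒a tt)

record FinType : Set₁ where
  field
    Carrier : Set
    card    : ℕ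
    enc     : Carrier ↔ Fin card

  encode : Carrier → Fin card
  encode = Inverse.to enc

  decode : Fin card → Carrier
  decode = Inverse.from enc

  decode-encode : ∀ x → decode (encode x) ≡ x
  decode-encode = Inverse.strictlyInverseʳ enc

open FinType public

unitFT : FinType
unitFT = record { Carrier = ⊤ ; card = 1 ; enc = ↔-sym 1↔⊤ }

finFT : ℕ → FinType
finFT n = record { Carrier = Fin n ; card = n ; enc = ↔-refl }

module _ (A : FinType) where

  FinType-≟ : DecidableEquality (Carrier A)
  FinType-≟ x y = map′ (to-injective (enc A)) (cong (encode A)) (encode A x Fin.≟ encode A y)

  FinType-all? : {P : Carrier A → Set} → (∀ x → Dec (P x)) → Dec (∀ x → P x)
  FinType-all? {P} P? = map′ (λ h x → subst P (decode-encode A x) (h (encode A x)))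
                             (λ h i → h (decode A i))
                             (all? (λ i → P? (decode A i)))

  FinType-any? : {P : Carrier A → Set} → (∀ x → Dec (P x)) → Dec (Σ (Carrier A) P)
  FinType-any? {P} P? = map′ (λ (i , p) → decode A i , p)
                             (λ (x , p) → encode A x , subst P (sym (decode-encode A x)) p)
                             (any? (λ i → P? (decode A i)))

card-↔ : (A B : FinType) → Carrier A ↔ Carrier B → card A ≡ card B
card-↔ A B A↔B = ↔⇒≡ (↔-trans (↔-sym (enc A)) (↔-trans A↔B (enc B)))

card-pos : (A : FinType) → Carrier A → 0 < card A
card-pos A x with card A | encode A x
... | suc _ | _ = s≤s z≤n

inhabitant : (A : FinType) → 0 < card A → Carrier A
inhabitant A 0<card = decode A (fromℕ< 0<card)

another : (A : FinType) → 1 < card A → (x : Carrier A) → Σ (Carrier A) (λ y → y ≢ x)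
another A 1<card x = pick (FinType-≟ A (decode A i₀) x)
  where
  i₀ i₁ : Fin (card A)
  i₀ = fromℕ< (<-trans (s≤s z≤n) 1<card)
  i₁ = fromℕ< 1<card
  i₀≢i₁ : i₀ ≢ i₁
  i₀≢i₁ i₀≡i₁ with trans (sym (toℕ-fromℕ< _)) (trans (cong toℕ i₀≡i₁) (toℕ-fromℕ< 1<card))
  ... | ()
  pick : Dec (decode A i₀ ≡ x) → Σ (Carrier A) (λ y → y ≢ x)
  pick (no  d₀≢x) = decode A i₀ , d₀≢x
  pick (yes d₀≡x) = decode A i₁ , λ d₁≡x → i₀≢i₁ (from-injective (enc A) (trans d₀≡x (sym d₁≡x)))

injective⇒surjective : ∀ {m n} (f : Fin m → Fin n) → (∀ a b → f a ≡ f b → a ≡ b) → n ≤ m →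
                       ∀ y → Σ (Fin m) (λ x → f x ≡ y)
injective⇒surjective {m} {suc n} f f-inj n≤m y with any? (λ x → f x Fin.≟ y)
... | yes preimage = preimage
... | no  ∄x       = ⊥-elim (<-irrefl refl (≤-trans n≤m (injective⇒≤ g-injective)))
  where
  g : Fin m → Fin n
  g x = punchOut {i = y} {j = f x} (λ y≡fx → ∄x (x , sym y≡fx))
  g-injective : ∀ {a b} → g a ≡ g b → a ≡ b
  g-injective {a} {b} eq =
    f-inj a b (punchOut-injective (λ y≡fa → ∄x (a , sym y≡fa)) (λ y≡fb → ∄x (b , sym y≡fb)) eq)

indicator : Bool → ℕ
indicator true  = 1
indicator false = 0

count : (n : ℕ) → (Fin n → Bool) → ℕ
count zero    P = 0
count (suc n) P = indicator (P zero) + count n (λ i → P (suc i))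

count-cong : ∀ n {P Q : Fin n → Bool} → (∀ i → P i ≡ Q i) → count n P ≡ count n Q
count-cong zero    P≡Q = refl
count-cong (suc n) P≡Q = cong₂ _+_ (cong indicator (P≡Q zero)) (count-cong n (λ i → P≡Q (suc i)))

count-true : ∀ n → count n (λ _ → true) ≡ n
count-true zero    = refl
count-true (suc n) = cong suc (count-true n)

count-split : ∀ n (P R : Fin n → Bool) →
              count n P ≡ count n (λ i → P i ∧ R i) + count n (λ i → P i ∧ not (R i))
count-split zero    P R = refl
count-split (suc n) P R with P zero | R zero
... | false | _     = count-split n _ _
... | true  | true  = cong suc (count-split n _ _)
... | true  | false = trans (cong suc (count-split n _ _)) (sym (+-suc _ _))

T↔indicator : ∀ b → T b ↔ Fin (indicator b)
T↔indicator true  = ↔-sym 1↔⊤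
T↔indicator false = mk↔ₛ′ (λ ()) (λ ()) (λ ()) (λ ())

Σ-Fin-suc↔ : ∀ n (P : Fin (suc n) → Set) → Σ (Fin (suc n)) P ↔ (P zero ⊎ Σ (Fin n) (λ i → P (suc i)))
Σ-Fin-suc↔ n P = mk↔ₛ′ split join split-join join-split
  where
  split : Σ (Fin (suc n)) P → P zero ⊎ Σ (Fin n) (λ i → P (suc i))
  split (zero  , p) = inj₁ p
  split (suc i , p) = inj₂ (i , p)
  join : P zero ⊎ Σ (Fin n) (λ i → P (suc i)) → Σ (Fin (suc n)) P
  join (inj₁ p)       = zero , p
  join (inj₂ (i , p)) = suc i , p
  split-join : ∀ y → split (join y) ≡ y
  split-join (inj₁ p)       = refl
  split-join (inj₂ (i , p)) = refl
  join-split : ∀ x → join (split x) ≡ x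
  join-split (zero  , p) = refl
  join-split (suc i , p) = refl

Σ-T↔count : ∀ n (P : Fin n → Bool) → Σ (Fin n) (λ i → T (P i)) ↔ Fin (count n P)
Σ-T↔count zero    P = mk↔ₛ′ (λ ()) (λ ()) (λ ()) (λ ())
Σ-T↔count (suc n) P = ↔-trans (Σ-Fin-suc↔ n (λ i → T (P i)))
  (↔-trans (T↔indicator (P zero) ⊎-↔ Σ-T↔count n (λ i → P (suc i))) (↔-sym +↔⊎))

Σ-T-transport : {A B : Set} (e : A ↔ B) (P : A → Bool) →
                Σ A (λ a → T (P a)) ↔ Σ B (λ b → T (P (Inverse.from e b)))
Σ-T-transport e P = mk↔ₛ′ to from to-from from-to
  where
  open Inverse e using () renaming (to to f; from to g)
  to : Σ _ (λ a → T (P a)) → Σ _ (λ b → T (P (g b)))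
  to (a , t) = f a , subst (λ z → T (P z)) (sym (Inverse.strictlyInverseʳ e a)) t
  from : Σ _ (λ b → T (P (g b))) → Σ _ (λ a → T (P a))
  from (b , t) = g b , t
  to-from : ∀ y → to (from y) ≡ y
  to-from (b , _) = Σ-≡-irrelevant T-irrelevant (Inverse.strictlyInverseˡ e b)
  from-to : ∀ x → from (to x) ≡ x
  from-to (a , _) = Σ-≡-irrelevant T-irrelevant (Inverse.strictlyInverseʳ e a)

subFT : (A : FinType) → (Carrier A → Bool) → FinType
subFT A P = record
  { Carrier = Σ (Carrier A) (λ a → T (P a))
  ; card    = count (card A) (λ i → P (decode A i))
  ; enc     = ↔-trans (Σ-T-transport (enc A) P) (Σ-T↔count _ _)
  }

module _ (A : FinType) where

  subFT-cong : {P Q : Carrier A → Bool} → (∀ x → P x ≡ Q x) → card (subFT A P) ≡ card (subFT A Q)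
  subFT-cong P≡Q = count-cong (card A) (λ i → P≡Q (decode A i))

  subFT-split : (P R : Carrier A → Bool) →
    card (subFT A P) ≡ card (subFT A (λ x → P x ∧ R x)) + card (subFT A (λ x → P x ∧ not (R x)))
  subFT-split P R = count-split (card A) _ _

  subFT-≡ : {P : Carrier A → Bool} {x y : Carrier (subFT A P)} → proj₁ x ≡ proj₁ y → x ≡ y
  subFT-≡ = Σ-≡-irrelevant T-irrelevant

  module _ (P : Carrier A → Bool) where

    card≡sub+complement : card A ≡ card (subFT A P) + card (subFT A (λ x → not (P x)))
    card≡sub+complement = trans (sym (count-true (card A))) (subFT-split (λ _ → true) P)

    subFT-≤ : card (subFT A P) ≤ card A
    subFT-≤ = subst (card (subFT A P) ≤_) (sym card≡sub+complement) (m≤m+n _ _)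

    subFT-< : (x : Carrier A) → ¬ T (P x) → card (subFT A P) < card A
    subFT-< x ¬Px = subst (card (subFT A P) <_) (sym card≡sub+complement)
      (m<m+n _ (card-pos (subFT A (λ x → not (P x))) (x , ¬T⇒T-not ¬Px)))
      where
      ¬T⇒T-not : ∀ {b} → ¬ T b → T (not b)
      ¬T⇒T-not {false} _  = tt
      ¬T⇒T-not {true}  ¬t = ¬t tt

Vec↔ : {A : Set} {k : ℕ} → A ↔ Fin k → ∀ m → Vec A m ↔ Fin (k ^ m)
Vec↔ e zero    = mk↔ₛ′ (λ _ → zero) (λ _ → []) (λ { zero → refl }) (λ { [] → refl })
Vec↔ e (suc m) = ↔-trans Vec-suc↔× (↔-trans (e ×-↔ Vec↔ e m) (↔-sym *↔×))
  where
  Vec-suc↔× : Vec _ (suc m) ↔ (_ × Vec _ m)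
  Vec-suc↔× = mk↔ₛ′ (λ { (x ∷ xs) → x , xs }) (λ (x , xs) → x ∷ xs) (λ _ → refl) (λ { (_ ∷ _) → refl })

vecFT : FinType → ℕ → FinType
vecFT A m = record { Carrier = Vec (Carrier A) m ; card = card A ^ m ; enc = Vec↔ (enc A) m }

-- Iteration; fold x f m is the iterate f^m x

module _ {A : Set} (f : A → A) where

  fold-suc : ∀ m x → fold x f (suc m) ≡ fold (f x) f m
  fold-suc m x = trans (cong (fold x f) (+-comm 1 m)) (fold-+ x f m)

  fold-periodic : ∀ {n x} → fold x f n ≡ x → ∀ k → fold x f (k * n) ≡ x
  fold-periodic         f^n≡x zero    = refl
  fold-periodic {n} {x} f^n≡x (suc k) = begin
    fold x f (n + k * n)        ≡⟨ fold-+ x f n ⟩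
    fold (fold x f (k * n)) f n ≡⟨ cong (λ y → fold y f n) (fold-periodic f^n≡x k) ⟩
    fold x f n                  ≡⟨ f^n≡x ⟩
    x                           ∎
    where open ≡-Reasoning

  module _ {n : ℕ} .{{_ : NonZero n}} where

    fold-mod : ∀ {x} → fold x f n ≡ x → ∀ m → fold x f m ≡ fold x f (m % n)
    fold-mod {x} f^n≡x m = begin
      fold x f m                                 ≡⟨ cong (fold x f) (m≡m%n+[m/n]*n m n) ⟩
      fold x f (m % n + (m / n) * n)             ≡⟨ fold-+ x f (m % n) ⟩
      fold (fold x f ((m / n) * n)) f (m % n)    ≡⟨ cong (λ y → fold y f (m % n)) (fold-periodic f^n≡x (m / n)) ⟩
      fold x f (m % n)                           ∎
      where open ≡-Reasoning

    module _ (f^n≡id : ∀ x → fold x f n ≡ x) where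

      fold-pred-inverse : ∀ y → fold (f y) f (n ∸ 1) ≡ y
      fold-pred-inverse y = begin
        fold (f y) f (n ∸ 1)        ≡⟨ sym (fold-suc (n ∸ 1) y) ⟩
        fold y f (suc (n ∸ 1))      ≡⟨ cong (fold y f) (suc-pred n) ⟩
        fold y f n                  ≡⟨ f^n≡id y ⟩
        y                           ∎
        where open ≡-Reasoning

      fold-injective : ∀ m {y z} → fold y f m ≡ fold z f m → y ≡ z
      fold-injective zero            eq = eq
      fold-injective (suc m) {y} {z} eq = fold-injective m (begin
        fold y f m                        ≡⟨ sym (fold-pred-inverse _) ⟩
        fold (fold y f (suc m)) f (n ∸ 1) ≡⟨ cong (λ w → fold w f (n ∸ 1)) eq ⟩
        fold (fold z f (suc m)) f (n ∸ 1) ≡⟨ fold-pred-inverse _ ⟩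
        fold z f m                        ∎)
        where open ≡-Reasoning

fold-cong : {A : Set} {f g : A → A} → (∀ x → f x ≡ g x) → ∀ x m → fold x f m ≡ fold x g m
fold-cong         f≗g x zero    = refl
fold-cong {f = f} f≗g x (suc m) = trans (cong f (fold-cong f≗g x m)) (f≗g _)

-- Bézout gives 1 + b m = a p or 1 + a p = b m, and both m and p are periods of x.
fixed-if-period-below-prime : ∀ {p} → Prime p → {A : Set} {f : A → A} {x : A} → fold x f p ≡ x →
                              ∀ {m} → 0 < m → m < p → fold x f m ≡ x → f x ≡ x
fixed-if-period-below-prime {p} p-prime {f = f} {x} f^p≡x {suc m} _ m<p f^m≡x
  with coprime-Bézout (prime⇒coprime p-prime m<p)
... | Bézout.+- a b eq = begin
  f x                         ≡⟨ cong f (sym (fold-periodic f f^m≡x b)) ⟩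
  fold x f (1 + b * suc m)    ≡⟨ cong (fold x f) eq ⟩
  fold x f (a * p)            ≡⟨ fold-periodic f f^p≡x a ⟩
  x                           ∎
  where open ≡-Reasoning
... | Bézout.-+ a b eq = begin
  f x                         ≡⟨ cong f (sym (fold-periodic f f^p≡x a)) ⟩
  fold x f (1 + a * p)        ≡⟨ cong (fold x f) eq ⟩
  fold x f (b * suc m)        ≡⟨ fold-periodic f f^m≡x b ⟩
  x                           ∎
  where open ≡-Reasoning

-- Fixed points of an action of prime order

module OrbitCounting {p : ℕ} (p-prime : Prime p) (A : FinType)
                     (f : Carrier A → Carrier A) (f^p≡id : ∀ x → fold x f p ≡ x) where

  private instance
    p≢0 : NonZero p
    p≢0 = prime⇒nonZero p-prime

  private
    _≟_ = FinType-≟ A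

  inOrbit : Carrier A → Carrier A → Bool
  inOrbit x y = isYes (any? (λ (j : Fin p) → fold x f (toℕ j) ≟ y))

  inOrbit-witness : ∀ {x y} → T (inOrbit x y) → Σ (Fin p) (λ j → fold x f (toℕ j) ≡ y)
  inOrbit-witness = toWitness

  inOrbit-fold : ∀ x m → T (inOrbit x (fold x f m))
  inOrbit-fold x m = fromWitness (fromℕ< (m%n<n m p) ,
    trans (cong (fold x f) (toℕ-fromℕ< (m%n<n m p))) (sym (fold-mod f (f^p≡id x) m)))

  inOrbit-invariant : ∀ x y → inOrbit x (f y) ≡ inOrbit x y
  inOrbit-invariant x y = isYes-⇔ (mk⇔ backward forward) _ _
    where
    backward : Σ (Fin p) (λ j → fold x f (toℕ j) ≡ f y) → Σ (Fin p) (λ j → fold x f (toℕ j) ≡ y)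
    backward (j , f^jx≡fy) = inOrbit-witness (subst (T ∘ inOrbit x) f^[p∸1+j]x≡y (inOrbit-fold x (p ∸ 1 + toℕ j)))
      where
      f^[p∸1+j]x≡y : fold x f (p ∸ 1 + toℕ j) ≡ y
      f^[p∸1+j]x≡y = trans (fold-+ x f (p ∸ 1)) (trans (cong (λ z → fold z f (p ∸ 1)) f^jx≡fy)
                                                       (fold-pred-inverse f f^p≡id y))
    forward : Σ (Fin p) (λ j → fold x f (toℕ j) ≡ y) → Σ (Fin p) (λ j → fold x f (toℕ j) ≡ f y)
    forward (j , f^jx≡y) = inOrbit-witness (subst (T ∘ inOrbit x) (cong f f^jx≡y) (inOrbit-fold x (suc (toℕ j))))

  module _ {x : Carrier A} (fx≢x : f x ≢ x) where

    iterates-distinct : ∀ {i j} → i < j → j < p → fold x f i ≢ fold x f j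
    iterates-distinct {i} {j} i<j j<p f^ix≡f^jx =
      fx≢x (fixed-if-period-below-prime p-prime (f^p≡id x) (m<n⇒0<n∸m i<j) (≤-<-trans (m∸n≤m j i) j<p)
             (fold-injective f f^p≡id i f^i[f^[j∸i]x]≡f^ix))
      where
      f^i[f^[j∸i]x]≡f^ix : fold (fold x f (j ∸ i)) f i ≡ fold x f i
      f^i[f^[j∸i]x]≡f^ix = begin
        fold (fold x f (j ∸ i)) f i ≡⟨ sym (fold-+ x f i) ⟩
        fold x f (i + (j ∸ i))      ≡⟨ cong (fold x f) (m+[n∸m]≡n (<⇒≤ i<j)) ⟩
        fold x f j                  ≡⟨ sym f^ix≡f^jx ⟩
        fold x f i                  ∎
        where open ≡-Reasoning

    orbit↔Fin : Carrier (subFT A (inOrbit x)) ↔ Fin p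
    orbit↔Fin = mk↔ₛ′ (λ (_ , t) → proj₁ (inOrbit-witness t))
                      (λ j → fold x f (toℕ j) , inOrbit-fold x (toℕ j))
                      to-from (λ (_ , t) → subFT-≡ A (proj₂ (inOrbit-witness t)))
      where
      to-from : ∀ j → proj₁ (inOrbit-witness (inOrbit-fold x (toℕ j))) ≡ j
      to-from j with inOrbit-witness (inOrbit-fold x (toℕ j))
      ... | j′ , f^j′x≡f^jx with <-cmp (toℕ j′) (toℕ j)
      ... | tri< j′<j _ _ = ⊥-elim (iterates-distinct j′<j (toℕ<n j) f^j′x≡f^jx)
      ... | tri≈ _ j′≡j _ = toℕ-injective j′≡j
      ... | tri> _ _ j<j′ = ⊥-elim (iterates-distinct j<j′ (toℕ<n j′) (sym f^j′x≡f^jx))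

    card-orbit : card (subFT A (inOrbit x)) ≡ p
    card-orbit = card-↔ (subFT A (inOrbit x)) (finFT p) orbit↔Fin

  Invariant : (Carrier A → Bool) → Set
  Invariant Q = ∀ y → Q (f y) ≡ Q y

  FixedPointFree : (Carrier A → Bool) → Set
  FixedPointFree Q = ∀ y → T (Q y) → f y ≢ y

  -- Strong induction: remove the orbit (of size p) of some element of Q.
  p∣card-fixedPointFree : ∀ Q → Invariant Q → FixedPointFree Q → p ∣ card (subFT A Q)
  p∣card-fixedPointFree Q = <-rec Motive remove-orbit (card (subFT A Q)) Q refl
    where
    Motive : ℕ → Set
    Motive c = ∀ Q → card (subFT A Q) ≡ c → Invariant Q → FixedPointFree Q → p ∣ c
    remove-orbit : ∀ c → (∀ {c′} → c′ < c → Motive c′) → Motive c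
    remove-orbit zero    _  _ _   _   _    = p ∣0
    remove-orbit (suc c) IH Q #Q≡c Q-inv Q-free =
      subst (p ∣_) (trans (sym #Q≡#orbit+#Q′) #Q≡c) (∣m∣n⇒∣m+n ∣-refl p∣#Q′)
      where
      witness : Carrier (subFT A Q)
      witness = inhabitant (subFT A Q) (subst (0 <_) (sym #Q≡c) (s≤s z≤n))
      x = proj₁ witness
      Qx = proj₂ witness
      O = inOrbit x
      Q′ : Carrier A → Bool
      Q′ y = Q y ∧ not (O y)
      O⊆Q : ∀ y → T (O y) → T (Q y)
      O⊆Q y t with inOrbit-witness t
      ... | j , refl = subst T (sym (Q-fold (toℕ j))) Qx
        where
        Q-fold : ∀ m → Q (fold x f m) ≡ Q x
        Q-fold zero    = refl
        Q-fold (suc m) = trans (Q-inv _) (Q-fold m)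
      #Q≡#orbit+#Q′ : card (subFT A Q) ≡ p + card (subFT A Q′)
      #Q≡#orbit+#Q′ = trans (subFT-split A Q O)
        (cong (_+ card (subFT A Q′)) (trans (subFT-cong A (λ y → ∧-redundantˡ (O⊆Q y))) (card-orbit (Q-free x Qx))))
      #Q′<suc-c : card (subFT A Q′) < suc c
      #Q′<suc-c = subst (card (subFT A Q′) <_) (trans (sym #Q≡#orbit+#Q′) #Q≡c)
                        (m<n+m _ (>-nonZero⁻¹ p))
      p∣#Q′ : p ∣ card (subFT A Q′)
      p∣#Q′ = IH #Q′<suc-c Q′ refl (λ y → cong₂ _∧_ (Q-inv y) (cong not (inOrbit-invariant x y)))
                                    (λ y t → Q-free y (proj₁ (Equivalence.to T-∧ t)))

  isFixed : Carrier A → Bool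
  isFixed y = isYes (f y ≟ y)

  nonFixed-invariant : Invariant (not ∘ isFixed)
  nonFixed-invariant y = cong not (isYes-⇔ (mk⇔ (fold-injective f f^p≡id 1) (cong f)) _ _)

  nonFixed-free : FixedPointFree (not ∘ isFixed)
  nonFixed-free y t fy≡y with f y ≟ y
  ... | yes _   = t
  ... | no fy≢y = fy≢y fy≡y

  card≡card-fixed-mod : card A % p ≡ card (subFT A isFixed) % p
  card≡card-fixed-mod with p∣card-fixedPointFree (not ∘ isFixed) nonFixed-invariant nonFixed-free
  ... | divides k #nonFixed≡k*p = begin
    card A % p                           ≡⟨ cong (_% p) (card≡sub+complement A isFixed) ⟩
    (#Fixed + #NonFixed) % p             ≡⟨ cong (λ n → (#Fixed + n) % p) #nonFixed≡k*p ⟩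
    (#Fixed + k * p) % p                 ≡⟨ [m+kn]%n≡m%n _ k p ⟩
    #Fixed % p                           ∎
    where
    open ≡-Reasoning
    #Fixed = card (subFT A isFixed)
    #NonFixed = card (subFT A (not ∘ isFixed))

-- Cauchy's theorem, by McKay's necklace argument

∣⇒∣^ : ∀ {d m} n → 0 < n → d ∣ m → d ∣ m ^ n
∣⇒∣^ (suc n) _ d∣m = ∣-trans d∣m (m∣m*n _)

rotateList : {A : Set} → List A → List A
rotateList []       = []
rotateList (x ∷ xs) = xs ++ [ x ]

rotateList-++ : {A : Set} (xs ys : List A) → fold (xs ++ ys) rotateList (length xs) ≡ ys ++ xs
rotateList-++ []       ys = sym (++-identityʳ ys)
rotateList-++ (x ∷ xs) ys = begin
  fold (x ∷ xs ++ ys) rotateList (suc (length xs)) ≡⟨ fold-suc rotateList (length xs) _ ⟩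
  fold ((xs ++ ys) ++ [ x ]) rotateList (length xs) ≡⟨ cong (λ zs → fold zs rotateList (length xs)) (++-assoc xs ys [ x ]) ⟩
  fold (xs ++ ys ++ [ x ]) rotateList (length xs)   ≡⟨ rotateList-++ xs (ys ++ [ x ]) ⟩
  (ys ++ [ x ]) ++ xs                              ≡⟨ ++-assoc ys [ x ] xs ⟩
  ys ++ x ∷ xs                                     ∎
  where open ≡-Reasoning

rotate : {A : Set} {n : ℕ} → Vec A n → Vec A n
rotate []       = []
rotate (x ∷ xs) = xs ∷ʳ x

toList-fold-rotate : {A : Set} {n : ℕ} (v : Vec A n) (m : ℕ) → toList (fold v rotate m) ≡ fold (toList v) rotateList m
toList-fold-rotate v zero    = refl
toList-fold-rotate v (suc m) with fold v rotate m | toList-fold-rotate v m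
... | []     | eq = cong rotateList eq
... | x ∷ xs | eq = trans (toList-∷ʳ x xs) (cong rotateList eq)

rotate-period : {A : Set} {n : ℕ} (v : Vec A n) → fold v rotate n ≡ v
rotate-period {n = n} v = trans (sym (cast-is-id refl _)) (toList-injective refl _ v (begin
  toList (fold v rotate n)                                 ≡⟨ toList-fold-rotate v n ⟩
  fold (toList v) rotateList n                             ≡⟨ cong (fold (toList v) rotateList) (sym (length-toList v)) ⟩
  fold (toList v) rotateList (length (toList v))           ≡⟨ cong (λ zs → fold zs rotateList (length (toList v))) (sym (++-identityʳ (toList v))) ⟩
  fold (toList v ++ []) rotateList (length (toList v))     ≡⟨ rotateList-++ (toList v) [] ⟩
  toList v                                                 ∎))
  where open ≡-Reasoning

rotate-fixed⇒replicate : {A : Set} {n : ℕ} (x : A) (xs : Vec A n) → xs ∷ʳ x ≡ x ∷ xs → xs ≡ replicate n x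
rotate-fixed⇒replicate x []       _  = refl
rotate-fixed⇒replicate x (y ∷ ys) eq with ∷-injective eq
... | refl , eq′ = cong (y ∷_) (rotate-fixed⇒replicate x ys eq′)

replicate-∷ʳ : {A : Set} (n : ℕ) (x : A) → replicate n x ∷ʳ x ≡ x ∷ replicate n x
replicate-∷ʳ zero    x = refl
replicate-∷ʳ (suc n) x = cong (x ∷_) (replicate-∷ʳ n x)

record FinGroup : Set₁ where
  infixl 7 _∙_
  field
    Elements  : FinType
    _∙_       : Carrier Elements → Carrier Elements → Carrier Elements
    ε         : Carrier Elements
    _⁻¹       : Carrier Elements → Carrier Elements
    assoc     : ∀ x y z → (x ∙ y) ∙ z ≡ x ∙ (y ∙ z)
    identityˡ : ∀ x → ε ∙ x ≡ x
    identityʳ : ∀ x → x ∙ ε ≡ x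
    inverseˡ  : ∀ x → x ⁻¹ ∙ x ≡ ε

  pow : Carrier Elements → ℕ → Carrier Elements
  pow g n = fold ε (g ∙_) n

module Cauchy (𝔾 : FinGroup) where
  open FinGroup 𝔾
  private
    G = Carrier Elements
    _≟_ = FinType-≟ Elements

  ∙≡ε⇒≡⁻¹ : ∀ {x y} → x ∙ y ≡ ε → y ≡ x ⁻¹
  ∙≡ε⇒≡⁻¹ {x} {y} x∙y≡ε = begin
    y               ≡⟨ sym (identityˡ y) ⟩
    ε ∙ y           ≡⟨ cong (_∙ y) (sym (inverseˡ x)) ⟩
    x ⁻¹ ∙ x ∙ y    ≡⟨ assoc _ _ _ ⟩
    x ⁻¹ ∙ (x ∙ y)  ≡⟨ cong (x ⁻¹ ∙_) x∙y≡ε ⟩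
    x ⁻¹ ∙ ε        ≡⟨ identityʳ _ ⟩
    x ⁻¹            ∎
    where open ≡-Reasoning

  product : ∀ {n} → Vec G n → G
  product []       = ε
  product (x ∷ xs) = x ∙ product xs

  product-∷ʳ : ∀ {n} (xs : Vec G n) x → product (xs ∷ʳ x) ≡ product xs ∙ x
  product-∷ʳ []       x = trans (identityʳ x) (sym (identityˡ x))
  product-∷ʳ (y ∷ ys) x = trans (cong (y ∙_) (product-∷ʳ ys x)) (sym (assoc y _ x))

  product-replicate : ∀ n g → product (replicate n g) ≡ pow g n
  product-replicate zero    g = refl
  product-replicate (suc n) g = cong (g ∙_) (product-replicate n g)

  product-rotate : ∀ {n} (v : Vec G n) → product v ≡ ε → product (rotate v) ≡ ε
  product-rotate []       _      = refl
  product-rotate (x ∷ xs) x∙xs≡ε = begin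
    product (xs ∷ʳ x)  ≡⟨ product-∷ʳ xs x ⟩
    product xs ∙ x     ≡⟨ cong (_∙ x) (∙≡ε⇒≡⁻¹ x∙xs≡ε) ⟩
    x ⁻¹ ∙ x           ≡⟨ inverseˡ x ⟩
    ε                  ∎
    where open ≡-Reasoning

  module Necklaces (q : ℕ) (p-prime : Prime (suc q)) where

    Necklace : FinType
    Necklace = subFT (vecFT Elements (suc q)) (λ v → isYes (product v ≟ ε))

    Necklace↔Vec : Carrier Necklace ↔ Vec G q
    Necklace↔Vec = mk↔ₛ′ unclasp clasp (λ _ → refl) clasp-unclasp
      where
      unclasp : Carrier Necklace → Vec G q
      unclasp (_ ∷ xs , _) = xs
      clasp : Vec G q → Carrier Necklace
      clasp xs = (product xs) ⁻¹ ∷ xs , fromWitness (inverseˡ _)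
      clasp-unclasp : ∀ w → clasp (unclasp w) ≡ w
      clasp-unclasp (x ∷ xs , t) = subFT-≡ (vecFT Elements (suc q))
        (cong (_∷ xs) (sym (∙≡ε⇒≡⁻¹ (trans (cong (_∙ x) (∙≡ε⇒≡⁻¹ (toWitness t))) (inverseˡ x)))))

    card-Necklace : card Necklace ≡ card Elements ^ q
    card-Necklace = card-↔ Necklace (vecFT Elements q) Necklace↔Vec

    rotateNecklace : Carrier Necklace → Carrier Necklace
    rotateNecklace (v , t) = rotate v , fromWitness (product-rotate v (toWitness t))

    rotateNecklace-period : ∀ w → fold w rotateNecklace (suc q) ≡ w
    rotateNecklace-period w = subFT-≡ (vecFT Elements (suc q)) (trans (proj₁-fold (suc q)) (rotate-period (proj₁ w)))
      where
      proj₁-fold : ∀ m → proj₁ (fold w rotateNecklace m) ≡ fold (proj₁ w) rotate m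
      proj₁-fold zero    = refl
      proj₁-fold (suc m) = cong rotate (proj₁-fold m)

    open OrbitCounting p-prime Necklace rotateNecklace rotateNecklace-period using (isFixed; card≡card-fixed-mod)

    Constant : FinType
    Constant = subFT Necklace isFixed

    bead : Carrier Constant → G
    bead ((x ∷ _ , _) , _) = x

    constant-replicate : ∀ w → proj₁ (proj₁ w) ≡ replicate (suc q) (bead w)
    constant-replicate ((x ∷ xs , _) , t) = cong (x ∷_) (rotate-fixed⇒replicate x xs (cong proj₁ (toWitness t)))

    bead-injective : ∀ w w′ → bead w ≡ bead w′ → w ≡ w′
    bead-injective w w′ eq = subFT-≡ Necklace (subFT-≡ (vecFT Elements (suc q))
      (trans (constant-replicate w) (trans (cong (replicate (suc q)) eq) (sym (constant-replicate w′)))))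

    bead-order : ∀ w → pow (bead w) (suc q) ≡ ε
    bead-order w@((v , t) , _) = trans (sym (product-replicate (suc q) (bead w)))
                                       (trans (cong product (sym (constant-replicate w))) (toWitness t))

    trivial : Carrier Constant
    trivial = (replicate (suc q) ε , fromWitness (trans (product-replicate (suc q) ε) (ε^n≡ε (suc q))))
            , fromWitness (subFT-≡ (vecFT Elements (suc q)) (replicate-∷ʳ q ε))
      where
      ε^n≡ε : ∀ n → pow ε n ≡ ε
      ε^n≡ε zero    = refl
      ε^n≡ε (suc n) = trans (cong (ε ∙_) (ε^n≡ε n)) (identityˡ ε)

    private instance
      p≢0 = prime⇒nonZero p-prime
      p-nonTrivial = prime⇒nonTrivial p-prime

    -- |Necklace| = |G|^q ≡ 0, so p divides the number of constant necklaces.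
    p∣|Constant| : suc q ∣ card Elements → suc q ∣ card Constant
    p∣|Constant| p∣|G| = m%n≡0⇒n∣m _ _ (trans (sym card≡card-fixed-mod)
      (n∣m⇒m%n≡0 _ _ (subst (suc q ∣_) (sym card-Necklace) (∣⇒∣^ q (s<s⁻¹ (nonTrivial⇒n>1 (suc q))) p∣|G|))))

    1<|Constant| : suc q ∣ card Elements → 1 < card Constant
    1<|Constant| p∣|G| = <-≤-trans (nonTrivial⇒n>1 (suc q))
                                   (∣⇒≤ {{>-nonZero (card-pos Constant trivial)}} (p∣|Constant| p∣|G|))

    element-of-order : suc q ∣ card Elements → Σ G (λ g → g ≢ ε × pow g (suc q) ≡ ε)
    element-of-order p∣|G| =
      let w , w≢trivial = another Constant (1<|Constant| p∣|G|) trivial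
      in  bead w , (λ bead≡ε → w≢trivial (bead-injective w trivial bead≡ε)) , bead-order w

  cauchy : ∀ {p} → Prime p → p ∣ card Elements → Σ G (λ g → g ≢ ε × pow g p ≡ ε)
  cauchy {zero}  p-prime = ⊥-elim (NonZero.nonZero (prime⇒nonZero p-prime))
  cauchy {suc q} p-prime = Necklaces.element-of-order q p-prime

-- Dependent products over Fin k, as nested pairs rather than functions so that equality is extensional

Π-Fin : (k : ℕ) → (Fin k → Set) → Set
Π-Fin zero    B = ⊤
Π-Fin (suc k) B = B zero × Π-Fin k (λ i → B (suc i))

lookupΠ : ∀ {k B} → Π-Fin k B → (i : Fin k) → B i
lookupΠ (x , _)  zero    = x
lookupΠ (_ , xs) (suc i) = lookupΠ xs i

tabulateΠ : ∀ {k B} → ((i : Fin k) → B i) → Π-Fin k B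
tabulateΠ {zero}  f = tt
tabulateΠ {suc k} f = f zero , tabulateΠ (λ i → f (suc i))

lookupΠ-tabulateΠ : ∀ {k B} (f : (i : Fin k) → B i) i → lookupΠ {k} {B} (tabulateΠ f) i ≡ f i
lookupΠ-tabulateΠ f zero    = refl
lookupΠ-tabulateΠ f (suc i) = lookupΠ-tabulateΠ (λ i → f (suc i)) i

Π-Fin-ext : ∀ {k B} (x y : Π-Fin k B) → (∀ i → lookupΠ x i ≡ lookupΠ y i) → x ≡ y
Π-Fin-ext {zero}  tt       tt       _  = refl
Π-Fin-ext {suc k} (x , xs) (y , ys) eq = cong₂ _,_ (eq zero) (Π-Fin-ext xs ys (λ i → eq (suc i)))

Π-Fin↔ : (k : ℕ) (B : Fin k → FinType) → Σ ℕ λ n → Π-Fin k (λ i → Carrier (B i)) ↔ Fin n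
Π-Fin↔ zero    B = 1 , enc unitFT
Π-Fin↔ (suc k) B with Π-Fin↔ k (λ i → B (suc i))
... | n , e = card (B zero) * n , ↔-trans (enc (B zero) ×-↔ e) (↔-sym *↔×)

ΠFT : (k : ℕ) → (Fin k → FinType) → FinType
ΠFT k B = record { Carrier = Π-Fin k (λ i → Carrier (B i)) ; card = proj₁ (Π-Fin↔ k B) ; enc = proj₂ (Π-Fin↔ k B) }

module _ {k : ℕ} where

  MapFamily : (Fin k → ℕ) → (Fin k → ℕ) → Set
  MapFamily n m = (i : Fin k) → Fin (n i) → Fin (m i)

  mapFamilyFT : (Fin k → ℕ) → (Fin k → ℕ) → FinType
  mapFamilyFT n m = ΠFT k (λ i → vecFT (finFT (m i)) (n i))

  module _ {n m : Fin k → ℕ} where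

    decodeMaps : Carrier (mapFamilyFT n m) → MapFamily n m
    decodeMaps c i = lookup (lookupΠ c i)

    encodeMaps : MapFamily n m → Carrier (mapFamilyFT n m)
    encodeMaps f = tabulateΠ (λ i → tabulate (f i))

    decodeMaps-encodeMaps : ∀ f i a → decodeMaps (encodeMaps f) i a ≡ f i a
    decodeMaps-encodeMaps f i a =
      trans (cong (λ v → lookup v a) (lookupΠ-tabulateΠ (λ i → tabulate (f i)) i)) (lookup∘tabulate (f i) a)

    decodeMaps-injective : ∀ c d → (∀ i a → decodeMaps c i a ≡ decodeMaps d i a) → c ≡ d
    decodeMaps-injective c d eq = Π-Fin-ext c d (λ i →
      trans (sym (tabulate∘lookup (lookupΠ c i))) (trans (tabulate-cong (eq i)) (tabulate∘lookup (lookupΠ d i))))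

module _ {k : ℕ} where

  tupleFT : (Fin k → ℕ) → List (Fin k) → FinType
  tupleFT sz is = record { Carrier = Tuple sz is ; card = proj₁ (Tuple↔ is) ; enc = proj₂ (Tuple↔ is) }
    where
    Tuple↔ : ∀ is → Σ ℕ λ n → Tuple sz is ↔ Fin n
    Tuple↔ []       = 1 , enc unitFT
    Tuple↔ (i ∷ is) with Tuple↔ is
    ... | n , e = sz i * n , ↔-trans (↔-refl ×-↔ e) (↔-sym *↔×)

  module _ {n m : Fin k → ℕ} where

    mapTuple-cong : {f g : MapFamily n m} → (∀ i a → f i a ≡ g i a) → ∀ is t → mapTuple f is t ≡ mapTuple g is t
    mapTuple-cong f≗g []       tt      = refl
    mapTuple-cong f≗g (i ∷ is) (a , t) = cong₂ _,_ (f≗g i a) (mapTuple-cong f≗g is t)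

    mapTuple-∘ : {l : Fin k → ℕ} (f : MapFamily m l) (g : MapFamily n m) →
                 ∀ is t → mapTuple f is (mapTuple g is t) ≡ mapTuple (λ i a → f i (g i a)) is t
    mapTuple-∘ f g []       tt      = refl
    mapTuple-∘ f g (i ∷ is) (a , t) = cong (_ ,_) (mapTuple-∘ f g is t)

  mapTuple-id : {n : Fin k → ℕ} → ∀ is (t : Tuple n is) → mapTuple (λ i a → a) is t ≡ t
  mapTuple-id []       tt      = refl
  mapTuple-id (i ∷ is) (a , t) = cong (a ,_) (mapTuple-id is t)

module _ {σ : Signature} where

  Maps : Structure σ → Structure σ → Set
  Maps J H = MapFamily (size J) (size H)

  record IsEmbedding (J H : Structure σ) (f : Maps J H) : Set where
    field
      injective : ∀ i a b → f i a ≡ f i b → a ≡ b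
      preserves : ∀ r t → rel J r t ≡ rel H r (mapTuple f (type σ r) t)
  open IsEmbedding public

  isEmbedding? : (J H : Structure σ) (f : Maps J H) → Dec (IsEmbedding J H f)
  isEmbedding? J H f = map′ (λ (inj , pres) → record { injective = inj ; preserves = pres })
                            (λ f-emb → injective f-emb , preserves f-emb)
    (FinType-all? (finFT (sorts σ)) (λ i → FinType-all? (finFT (size J i)) (λ a →
       FinType-all? (finFT (size J i)) (λ b → injectiveAt? i a b)))
     ×-dec FinType-all? (finFT (nsym σ)) (λ r → FinType-all? (tupleFT (size J) (type σ r)) (λ t →
       rel J r t Bool.≟ rel H r (mapTuple f (type σ r) t))))
    where
    injectiveAt? : ∀ i a b → Dec (f i a ≡ f i b → a ≡ b)
    injectiveAt? i a b with f i a Fin.≟ f i b | a Fin.≟ b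
    ... | _         | yes a≡b = yes (λ _ → a≡b)
    ... | yes fa≡fb | no  a≢b = no (λ inj → a≢b (inj fa≡fb))
    ... | no  fa≢fb | no  _   = yes (λ fa≡fb → ⊥-elim (fa≢fb fa≡fb))

  -- An embedding is stored as the table of its values, so that embeddings form a finite type.
  record Embedding (J H : Structure σ) : Set where
    constructor _,_
    field
      table       : Carrier (mapFamilyFT (size J) (size H))
      isEmbedding : T (isYes (isEmbedding? J H (decodeMaps table)))

  embFT : Structure σ → Structure σ → FinType
  embFT J H = record { Carrier = Embedding J H ; card = card Tables ; enc = ↔-trans Embedding↔Tables (enc Tables) }
    where
    Tables = subFT (mapFamilyFT (size J) (size H)) (λ c → isYes (isEmbedding? J H (decodeMaps c)))
    Embedding↔Tables : Embedding J H ↔ Carrier Tables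
    Embedding↔Tables = mk↔ₛ′ (λ (c , t) → c , t) (λ (c , t) → c , t) (λ _ → refl) (λ _ → refl)

  module _ {J H : Structure σ} where

    ⟦_⟧ : Embedding J H → Maps J H
    ⟦ e ⟧ = decodeMaps (Embedding.table e)

    ⟦⟧-isEmbedding : (e : Embedding J H) → IsEmbedding J H ⟦ e ⟧
    ⟦⟧-isEmbedding e = toWitness (Embedding.isEmbedding e)

    abstract
      embedding : (f : Maps J H) → IsEmbedding J H f → Embedding J H
      embedding f f-emb = encodeMaps f , fromWitness (record
        { injective = λ i a b eq → injective f-emb i a b
                        (trans (sym (decodeMaps-encodeMaps f i a)) (trans eq (decodeMaps-encodeMaps f i b)))
        ; preserves = λ r t → trans (preserves f-emb r t)
                        (cong (rel H r) (mapTuple-cong (λ i a → sym (decodeMaps-encodeMaps f i a)) (type σ r) t))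
        })

      ⟦embedding⟧ : ∀ f (f-emb : IsEmbedding J H f) i a → ⟦ embedding f f-emb ⟧ i a ≡ f i a
      ⟦embedding⟧ f _ = decodeMaps-encodeMaps f

    embedding-ext : ∀ (e e′ : Embedding J H) → (∀ i a → ⟦ e ⟧ i a ≡ ⟦ e′ ⟧ i a) → e ≡ e′
    embedding-ext (c , t) (c′ , t′) eq with decodeMaps-injective c c′ eq
    ... | refl = cong (c ,_) (T-irrelevant t t′)

  id-isEmbedding : (H : Structure σ) → IsEmbedding H H (λ i a → a)
  id-isEmbedding H = record
    { injective = λ i a b eq → eq
    ; preserves = λ r t → cong (rel H r) (sym (mapTuple-id (type σ r) t))
    }

  module _ {J H K : Structure σ} where

    ∘-isEmbedding : {g : Maps H K} {f : Maps J H} → IsEmbedding H K g → IsEmbedding J H f →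
                    IsEmbedding J K (λ i a → g i (f i a))
    ∘-isEmbedding {g} {f} g-emb f-emb = record
      { injective = λ i a b eq → injective f-emb i a b (injective g-emb i _ _ eq)
      ; preserves = λ r t → trans (preserves f-emb r t)
                      (trans (preserves g-emb r _) (cong (rel K r) (mapTuple-∘ g f (type σ r) t)))
      }

    abstract
      postcompose : (g : Maps H K) → IsEmbedding H K g → Embedding J H → Embedding J K
      postcompose g g-emb e = embedding (λ i a → g i (⟦ e ⟧ i a)) (∘-isEmbedding g-emb (⟦⟧-isEmbedding e))

      ⟦postcompose⟧ : ∀ g g-emb e i a → ⟦ postcompose g g-emb e ⟧ i a ≡ g i (⟦ e ⟧ i a)
      ⟦postcompose⟧ g g-emb e = ⟦embedding⟧ _ (∘-isEmbedding g-emb (⟦⟧-isEmbedding e))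

  rightInverse-isEmbedding : {H K : Structure σ} {f : Maps H K} {g : Maps K H} →
    IsEmbedding H K f → (∀ i b → f i (g i b) ≡ b) → IsEmbedding K H g
  rightInverse-isEmbedding {H} {K} {f} {g} f-emb f∘g≗id = record
    { injective = λ i a b eq → trans (sym (f∘g≗id i a)) (trans (cong (f i) eq) (f∘g≗id i b))
    ; preserves = λ r s → sym (begin
      rel H r (mapTuple g (type σ r) s)                        ≡⟨ preserves f-emb r _ ⟩
      rel K r (mapTuple f (type σ r) (mapTuple g (type σ r) s)) ≡⟨ cong (rel K r) (mapTuple-∘ f g (type σ r) s) ⟩
      rel K r (mapTuple (λ i a → f i (g i a)) (type σ r) s)     ≡⟨ cong (rel K r) (mapTuple-cong f∘g≗id (type σ r) s) ⟩
      rel K r (mapTuple (λ i a → a) (type σ r) s)              ≡⟨ cong (rel K r) (mapTuple-id (type σ r) s) ⟩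
      rel K r s                                               ∎)
    }
    where open ≡-Reasoning

  module _ {H H′ : Structure σ} (I : Iso H H′) where

    private
      φ : Maps H H′
      φ i = Inverse.to (Iso.bij I i)
      φ⁻¹ : Maps H′ H
      φ⁻¹ i = Inverse.from (Iso.bij I i)

    iso-isEmbedding : IsEmbedding H H′ φ
    iso-isEmbedding = record { injective = λ i a b → to-injective (Iso.bij I i) ; preserves = Iso.pres I }

    iso⁻¹-isEmbedding : IsEmbedding H′ H φ⁻¹
    iso⁻¹-isEmbedding = rightInverse-isEmbedding iso-isEmbedding (λ i → Inverse.strictlyInverseˡ (Iso.bij I i))

    embeddings↔ : (J : Structure σ) → Embedding J H ↔ Embedding J H′
    embeddings↔ J = mk↔ₛ′ (postcompose φ iso-isEmbedding) (postcompose φ⁻¹ iso⁻¹-isEmbedding)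
      (λ e → embedding-ext _ e (λ i a → trans (⟦postcompose⟧ _ _ _ i a)
               (trans (cong (φ i) (⟦postcompose⟧ _ _ _ i a)) (Inverse.strictlyInverseˡ (Iso.bij I i) _))))
      (λ e → embedding-ext _ e (λ i a → trans (⟦postcompose⟧ _ _ _ i a)
               (trans (cong (φ⁻¹ i) (⟦postcompose⟧ _ _ _ i a)) (Inverse.strictlyInverseʳ (Iso.bij I i) _))))

    card-embFT-iso : ∀ J → card (embFT J H) ≡ card (embFT J H′)
    card-embFT-iso J = card-↔ (embFT J H) (embFT J H′) (embeddings↔ J)

  Iso-refl : (H : Structure σ) → Iso H H
  Iso-refl H = record { bij = λ i → ↔-refl ; pres = preserves (id-isEmbedding H) }

-- Embedding counts modulo p along →ₚ

iter≡fold : {σ : Signature} {A : Set} (f : A → A) → ∀ m a → iter {σ = σ} f m a ≡ fold a f m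
iter≡fold f zero    a = refl
iter≡fold {σ} f (suc m) a = cong f (iter≡fold {σ} f m a)

module _ {σ : Signature} {p : ℕ} where

  orderP⇒period : {H : Structure σ} (π : Automorphism H) → OrderP p π → ∀ i a → fold a (component π i) p ≡ a
  orderP⇒period π (order , _) i a with order i
  ... | inj₁ π-id        = idem p
    where
    idem : ∀ m → fold a (component π i) m ≡ a
    idem zero    = refl
    idem (suc m) = trans (π-id _) (idem m)
  ... | inj₂ (π^p≡id , _) = trans (sym (iter≡fold {σ} _ p a)) (π^p≡id a)

  -- Embeddings into H fixed by composition with π are the embeddings into H^π.
  module StepInvariance (p-prime : Prime p) {H H′ : Structure σ} (π : Automorphism H)
                        (π-period : ∀ i a → fold a (component π i) p ≡ a)
                        (H′≅Hπ : IsoFix H′ π) (J : Structure σ) where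

    private instance
      p≢0 : NonZero p
      p≢0 = prime⇒nonZero p-prime

    act : Embedding J H → Embedding J H
    act = postcompose (component π) (iso-isEmbedding π)

    ⟦fold-act⟧ : ∀ m e i a → ⟦ fold e act m ⟧ i a ≡ fold (⟦ e ⟧ i a) (component π i) m
    ⟦fold-act⟧ zero    e i a = refl
    ⟦fold-act⟧ (suc m) e i a = trans (⟦postcompose⟧ _ _ _ i a) (cong (component π i) (⟦fold-act⟧ m e i a))

    act-period : ∀ e → fold e act p ≡ e
    act-period e = embedding-ext _ e (λ i a → trans (⟦fold-act⟧ p e i a) (π-period i _))

    open OrbitCounting p-prime (embFT J H) act act-period using (isFixed; card≡card-fixed-mod)

    Fixed : FinType
    Fixed = subFT (embFT J H) isFixed

    private
      ψ = proj₁ H′≅Hπ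

    ρ : Maps H′ H
    ρ i b = proj₁ (Inverse.to (ψ i) b)

    ρ-isEmbedding : IsEmbedding H′ H ρ
    ρ-isEmbedding = record
      { injective = λ i a b eq → to-injective (ψ i) (Σ-≡-irrelevant (Fin-≡-irrelevant) eq)
      ; preserves = proj₂ H′≅Hπ
      }

    fixed-by-π : (e : Carrier Fixed) → ∀ i a → component π i (⟦ proj₁ e ⟧ i a) ≡ ⟦ proj₁ e ⟧ i a
    fixed-by-π (e , e-fixed) i a = trans (sym (⟦postcompose⟧ _ _ e i a)) (cong (λ e′ → ⟦ e′ ⟧ i a) (toWitness e-fixed))

    corestrict : Carrier Fixed → Maps J H′
    corestrict e i a = Inverse.from (ψ i) (⟦ proj₁ e ⟧ i a , fixed-by-π e i a)

    ρ-corestrict : ∀ e i a → ρ i (corestrict e i a) ≡ ⟦ proj₁ e ⟧ i a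
    ρ-corestrict e i a = cong proj₁ (Inverse.strictlyInverseˡ (ψ i) _)

    corestrict-isEmbedding : ∀ e → IsEmbedding J H′ (corestrict e)
    corestrict-isEmbedding e = record
      { injective = λ i a b eq → injective e-emb i a b
                      (trans (sym (ρ-corestrict e i a)) (trans (cong (ρ i) eq) (ρ-corestrict e i b)))
      ; preserves = λ r t → trans (preserves e-emb r t) (sym (trans (preserves ρ-isEmbedding r _) (cong (rel H r)
                      (trans (mapTuple-∘ ρ (corestrict e) (type σ r) t) (mapTuple-cong (ρ-corestrict e) (type σ r) t)))))
      }
      where e-emb = ⟦⟧-isEmbedding (proj₁ e)

    fixedEmbeddings↔ : Carrier Fixed ↔ Embedding J H′
    fixedEmbeddings↔ = mk↔ₛ′ (λ e → embedding (corestrict e) (corestrict-isEmbedding e)) from to-from from-to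
      where
      from : Embedding J H′ → Carrier Fixed
      from e′ = postcompose ρ ρ-isEmbedding e′ , fromWitness (embedding-ext _ _ (λ i a →
        trans (⟦postcompose⟧ _ _ _ i a) (trans (cong (component π i) (⟦postcompose⟧ _ _ e′ i a))
          (trans (proj₂ (Inverse.to (ψ i) (⟦ e′ ⟧ i a))) (sym (⟦postcompose⟧ _ _ e′ i a))))))
      to-from : ∀ e′ → embedding (corestrict (from e′)) (corestrict-isEmbedding (from e′)) ≡ e′
      to-from e′ = embedding-ext _ e′ (λ i a → trans (⟦embedding⟧ _ _ i a)
        (trans (cong (Inverse.from (ψ i)) (Σ-≡-irrelevant (Fin-≡-irrelevant) (⟦postcompose⟧ _ _ e′ i a)))
               (Inverse.strictlyInverseʳ (ψ i) _)))
      from-to : ∀ e → from (embedding (corestrict e) (corestrict-isEmbedding e)) ≡ e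
      from-to e = subFT-≡ (embFT J H) (embedding-ext _ _ (λ i a →
        trans (⟦postcompose⟧ _ _ _ i a) (trans (cong (ρ i) (⟦embedding⟧ _ _ i a)) (ρ-corestrict e i a))))

    card-embFT-step : card (embFT J H) % p ≡ card (embFT J H′) % p
    card-embFT-step = trans card≡card-fixed-mod
      (cong (_% p) (card-↔ Fixed (embFT J H′) fixedEmbeddings↔))

module _ {σ : Signature} where

  -- Self-embeddings of a finite structure are bijective, so they form its automorphism group.
  module AutomorphismGroup (H : Structure σ) where

    _∘ₑ_ : Embedding H H → Embedding H H → Embedding H H
    e ∘ₑ e′ = postcompose ⟦ e ⟧ (⟦⟧-isEmbedding e) e′

    idₑ : Embedding H H
    idₑ = embedding (λ i a → a) (id-isEmbedding H)

    ⟦idₑ⟧ : ∀ i a → ⟦ idₑ ⟧ i a ≡ a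
    ⟦idₑ⟧ = ⟦embedding⟧ _ _

    preimage : (e : Embedding H H) → ∀ i b → Σ (Fin (size H i)) (λ a → ⟦ e ⟧ i a ≡ b)
    preimage e i = injective⇒surjective (⟦ e ⟧ i) (injective (⟦⟧-isEmbedding e) i) ≤-refl

    _⁻¹ₑ : Embedding H H → Embedding H H
    e ⁻¹ₑ = embedding (λ i b → proj₁ (preimage e i b))
                      (rightInverse-isEmbedding (⟦⟧-isEmbedding e) (λ i b → proj₂ (preimage e i b)))

    ⟦e⟧∘⟦e⁻¹⟧ : ∀ e i b → ⟦ e ⟧ i (⟦ e ⁻¹ₑ ⟧ i b) ≡ b
    ⟦e⟧∘⟦e⁻¹⟧ e i b = trans (cong (⟦ e ⟧ i) (⟦embedding⟧ _ _ i b)) (proj₂ (preimage e i b))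

    ⟦e⁻¹⟧∘⟦e⟧ : ∀ e i a → ⟦ e ⁻¹ₑ ⟧ i (⟦ e ⟧ i a) ≡ a
    ⟦e⁻¹⟧∘⟦e⟧ e i a = injective (⟦⟧-isEmbedding e) i _ _ (⟦e⟧∘⟦e⁻¹⟧ e i _)

    Aut : FinGroup
    Aut = record
      { Elements  = embFT H H
      ; _∙_       = _∘ₑ_
      ; ε         = idₑ
      ; _⁻¹       = _⁻¹ₑ
      ; assoc     = λ e₁ e₂ e₃ → embedding-ext _ _ (λ i a → trans (⟦postcompose⟧ _ _ _ i a)
                      (trans (⟦postcompose⟧ _ _ _ i _) (sym (trans (⟦postcompose⟧ _ _ _ i a)
                        (cong (⟦ e₁ ⟧ i) (⟦postcompose⟧ _ _ _ i a))))))
      ; identityˡ = λ e → embedding-ext _ _ (λ i a → trans (⟦postcompose⟧ _ _ _ i a) (⟦idₑ⟧ i _))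
      ; identityʳ = λ e → embedding-ext _ _ (λ i a → trans (⟦postcompose⟧ _ _ _ i a) (cong (⟦ e ⟧ i) (⟦idₑ⟧ i a)))
      ; inverseˡ  = λ e → embedding-ext _ _ (λ i a → trans (⟦postcompose⟧ _ _ _ i a)
                      (trans (⟦e⁻¹⟧∘⟦e⟧ e i a) (sym (⟦idₑ⟧ i a))))
      }

    open FinGroup Aut using (pow)

    ⟦pow⟧ : ∀ e m i a → ⟦ pow e m ⟧ i a ≡ fold a (⟦ e ⟧ i) m
    ⟦pow⟧ e zero    i a = ⟦idₑ⟧ i a
    ⟦pow⟧ e (suc m) i a = trans (⟦postcompose⟧ _ _ _ i a) (cong (⟦ e ⟧ i) (⟦pow⟧ e m i a))

    toAutomorphism : Embedding H H → Automorphism H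
    toAutomorphism e = record
      { bij  = λ i → mk↔ₛ′ (⟦ e ⟧ i) (⟦ e ⁻¹ₑ ⟧ i) (⟦e⟧∘⟦e⁻¹⟧ e i) (⟦e⁻¹⟧∘⟦e⟧ e i)
      ; pres = preserves (⟦⟧-isEmbedding e)
      }

    fromAutomorphism : Automorphism H → Embedding H H
    fromAutomorphism π = embedding (component π) (iso-isEmbedding π)

    module _ {p : ℕ} (p-prime : Prime p) where

      OfOrder : Embedding H H → Set
      OfOrder e = e ≢ idₑ × pow e p ≡ idₑ

      ofOrder⇒orderP : ∀ e → OfOrder e → OrderP p (toAutomorphism e)
      ofOrder⇒orderP e (e≢id , eᵖ≡id) = identity-or-order-p , nonIdentity
        where
        identity? : ∀ i → Dec (IsIdentity {σ} (⟦ e ⟧ i))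
        identity? i = all? (λ a → ⟦ e ⟧ i a Fin.≟ a)
        period : ∀ i a → fold a (⟦ e ⟧ i) p ≡ a
        period i a = trans (sym (⟦pow⟧ e p i a)) (trans (cong (λ e′ → ⟦ e′ ⟧ i a) eᵖ≡id) (⟦idₑ⟧ i a))
        identity-or-order-p : ∀ i → IsIdentity {σ} (⟦ e ⟧ i) ⊎ HasOrder {σ} p (⟦ e ⟧ i)
        identity-or-order-p i with identity? i
        ... | yes e-id = inj₁ e-id
        ... | no  e≢id = inj₂ ( (λ a → trans (iter≡fold {σ} _ p a) (period i a))
                              , λ m 0<m m<p eᵐ-id → e≢id (λ a →
                                  fixed-if-period-below-prime p-prime (period i a) 0<m m<p (trans (sym (iter≡fold {σ} _ m a)) (eᵐ-id a))))
        nonIdentity : Σ (Fin (sorts σ)) (λ i → ¬ IsIdentity {σ} (⟦ e ⟧ i))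
        nonIdentity = ¬∀⟶∃¬ (sorts σ) _ identity? (λ e-id → e≢id (embedding-ext _ _ (λ i a → trans (e-id i a) (sym (⟦idₑ⟧ i a)))))

      orderP⇒ofOrder : ∀ π → OrderP p π → OfOrder (fromAutomorphism π)
      orderP⇒ofOrder π order-p@(_ , i , πᵢ≢id) =
        (λ π≡id → πᵢ≢id (λ a → trans (sym (⟦embedding⟧ _ _ i a)) (trans (cong (λ e → ⟦ e ⟧ i a) π≡id) (⟦idₑ⟧ i a)))) ,
        embedding-ext _ _ (λ j a → begin
          ⟦ pow (fromAutomorphism π) p ⟧ j a          ≡⟨ ⟦pow⟧ _ p j a ⟩
          fold a (⟦ fromAutomorphism π ⟧ j) p          ≡⟨ fold-cong (⟦embedding⟧ _ _ j) a p ⟩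
          fold a (component π j) p                     ≡⟨ orderP⇒period π order-p j a ⟩
          a                                            ≡⟨ sym (⟦idₑ⟧ j a) ⟩
          ⟦ idₑ ⟧ j a                                  ∎)
        where open ≡-Reasoning

      rigid⊎orderP : Rigid p H ⊎ Σ (Automorphism H) (OrderP p)
      rigid⊎orderP = decide (FinType-any? (embFT H H) (λ e → ¬? (FinType-≟ (embFT H H) e idₑ)
                                                 ×-dec FinType-≟ (embFT H H) (pow e p) idₑ))
        where
        decide : Dec (Σ (Embedding H H) OfOrder) → Rigid p H ⊎ Σ (Automorphism H) (OrderP p)
        decide (yes (e , e-order)) = inj₂ (toAutomorphism e , ofOrder⇒orderP e e-order)
        decide (no  ∄e)            = inj₁ (λ (π , π-order) → ∄e (fromAutomorphism π , orderP⇒ofOrder π π-order))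

      rigid⇒p∤|Aut| : Rigid p H → ¬ p ∣ card (embFT H H)
      rigid⇒p∤|Aut| rigid p∣|Aut| =
        let e , e-order = Cauchy.cauchy Aut p-prime p∣|Aut|
        in  rigid (toAutomorphism e , ofOrder⇒orderP e e-order)

-- The rigid structure reached from H

sumFin : (k : ℕ) → (Fin k → ℕ) → ℕ
sumFin zero    f = 0
sumFin (suc k) f = f zero + sumFin k (λ i → f (suc i))

sumFin-mono-≤ : ∀ k {f g : Fin k → ℕ} → (∀ i → f i ≤ g i) → sumFin k f ≤ sumFin k g
sumFin-mono-≤ zero    f≤g = z≤n
sumFin-mono-≤ (suc k) f≤g = +-mono-≤ (f≤g zero) (sumFin-mono-≤ k (λ i → f≤g (suc i)))

sumFin-mono-< : ∀ k {f g : Fin k → ℕ} → (∀ i → f i ≤ g i) → ∀ j → f j < g j → sumFin k f < sumFin k g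
sumFin-mono-< (suc k) f≤g zero    fj<gj = +-mono-<-≤ fj<gj (sumFin-mono-≤ k (λ i → f≤g (suc i)))
sumFin-mono-< (suc k) f≤g (suc j) fj<gj = +-mono-≤-< (f≤g zero) (sumFin-mono-< k (λ i → f≤g (suc i)) j fj<gj)

module _ {σ : Signature} where

  totalSize : Structure σ → ℕ
  totalSize H = sumFin (sorts σ) (size H)

  -- H^π, with the fixed points of π_i enumerated by Fin
  module FixedSubstructure {H : Structure σ} (π : Automorphism H) where

    isFixedAt : ∀ i → Fin (size H i) → Bool
    isFixedAt i a = isYes (component π i a Fin.≟ a)

    FixFT : Fin (sorts σ) → FinType
    FixFT i = subFT (finFT (size H i)) (isFixedAt i)

    Fin↔Fix : ∀ i → Fin (card (FixFT i)) ↔ Fix π i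
    Fin↔Fix i = ↔-trans (↔-sym (enc (FixFT i)))
      (mk↔ₛ′ (λ (a , t) → a , toWitness t) (λ (a , eq) → a , fromWitness eq)
             (λ _ → Σ-≡-irrelevant (Fin-≡-irrelevant) refl)
             (λ _ → Σ-≡-irrelevant T-irrelevant refl))

    Hπ : Structure σ
    Hπ = record
      { size = λ i → card (FixFT i)
      ; rel  = λ r t → rel H r (mapTuple (λ i a → proj₁ (Inverse.to (Fin↔Fix i) a)) (type σ r) t)
      }

    Hπ-isoFix : IsoFix Hπ π
    Hπ-isoFix = Fin↔Fix , λ r t → refl

    Hπ-smaller : ∀ {p} → OrderP p π → totalSize Hπ < totalSize H
    Hπ-smaller (_ , i , πᵢ≢id) =
      let a , πa≢a = ¬∀⟶∃¬ (size H i) _ (λ a → component π i a Fin.≟ a) πᵢ≢id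
      in  sumFin-mono-< (sorts σ) (λ j → subFT-≤ (finFT (size H j)) (isFixedAt j)) i
                        (subFT-< (finFT (size H i)) (isFixedAt i) a (λ t → πa≢a (toWitness t)))

  module _ {p : ℕ} (p-prime : Prime p) where

    private instance
      p≢0 : NonZero p
      p≢0 = prime⇒nonZero p-prime

    rigid-reachable : (H : Structure σ) → Σ (Structure σ) (λ H* → Rigid p H* × Steps p H H*)
    rigid-reachable H = go H (<-wellFounded (totalSize H))
      where
      go : (H : Structure σ) → Acc _<_ (totalSize H) → Σ (Structure σ) (λ H* → Rigid p H* × Steps p H H*)
      go H (acc smaller) = [ stop , continue ]′ (AutomorphismGroup.rigid⊎orderP H p-prime)
        where
        stop : Rigid p H → Σ (Structure σ) (λ H* → Rigid p H* × Steps p H H*)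
        stop rigid = H , rigid , done (Iso-refl H)
        continue : Σ (Automorphism H) (OrderP p) → Σ (Structure σ) (λ H* → Rigid p H* × Steps p H H*)
        continue (π , order-p) =
          let H* , rigid , steps = go Hπ (smaller (Hπ-smaller order-p))
          in  H* , rigid , step (π , order-p , Hπ-isoFix) steps
          where open FixedSubstructure π

    steps-card-embFT : ∀ {H H′ : Structure σ} → Steps p H H′ → ∀ J → card (embFT J H) % p ≡ card (embFT J H′) % p
    steps-card-embFT (done I)                              J = cong (_% p) (card-embFT-iso I J)
    steps-card-embFT (step (π , order-p , isoFix) steps) J =
      trans (StepInvariance.card-embFT-step p-prime π (orderP⇒period π order-p) isoFix J) (steps-card-embFT steps J)

    reach-card-embFT : ∀ {H H′ : Structure σ} → Reach p H H′ → ∀ J → card (embFT J H) % p ≡ card (embFT J H′) % p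
    reach-card-embFT (_ , I , steps) J = trans (cong (_% p) (card-embFT-iso I J)) (steps-card-embFT steps J)

    -- |Emb(H₁, H₂)| ≡ |Emb(H₁, H)| ≡ |Emb(H₁, H₁)| = |Aut H₁| mod p, which is nonzero by rigidity.
    rigid-embeds : ∀ {H H₁ H₂ : Structure σ} → Rigid p H₁ → Reach p H H₁ → Reach p H H₂ → Embedding H₁ H₂
    rigid-embeds {H} {H₁} {H₂} rigid reach₁ reach₂ = inhabitant (embFT H₁ H₂) (n≢0⇒n>0 λ |Emb|≡0 →
      AutomorphismGroup.rigid⇒p∤|Aut| H₁ p-prime rigid (m%n≡0⇒n∣m _ p (begin
        card (embFT H₁ H₁) % p  ≡⟨ sym (reach-card-embFT reach₁ H₁) ⟩
        card (embFT H₁ H) % p   ≡⟨ reach-card-embFT reach₂ H₁ ⟩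
        card (embFT H₁ H₂) % p  ≡⟨ cong (_% p) |Emb|≡0 ⟩
        0 % p                   ≡⟨ m*n%n≡0 0 p ⟩
        0                       ∎)))
      where open ≡-Reasoning

  mutual-embeddings⇒Iso : ∀ {H₁ H₂ : Structure σ} → Embedding H₁ H₂ → Embedding H₂ H₁ → Iso H₁ H₂
  mutual-embeddings⇒Iso {H₁} {H₂} e e′ = record { bij = bij ; pres = preserves (⟦⟧-isEmbedding e) }
    where
    e-inj = injective (⟦⟧-isEmbedding e)
    same-size : ∀ i → size H₁ i ≡ size H₂ i
    same-size i = cantor-schröder-bernstein (e-inj i _ _) (injective (⟦⟧-isEmbedding e′) i _ _)
    preimage : ∀ i b → Σ (Fin (size H₁ i)) (λ a → ⟦ e ⟧ i a ≡ b)
    preimage i = injective⇒surjective (⟦ e ⟧ i) (e-inj i) (≤-reflexive (sym (same-size i)))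
    bij : ∀ i → Fin (size H₁ i) ↔ Fin (size H₂ i)
    bij i = mk↔ₛ′ (⟦ e ⟧ i) (λ b → proj₁ (preimage i b)) (λ b → proj₂ (preimage i b))
                  (λ a → e-inj i _ _ (proj₂ (preimage i (⟦ e ⟧ i a))))

proposition2p1 : (σ : Signature) (H : Structure σ) (p : ℕ) → Prime p →
    Σ (Structure σ) (λ Hp → Rigid p Hp × Reach p H Hp) ×
    ((H₁ H₂ : Structure σ) → Rigid p H₁ → Reach p H H₁ →
      Rigid p H₂ → Reach p H H₂ → Iso H₁ H₂)
proposition2p1 σ H p p-prime = existence , uniqueness
  where
  existence : Σ (Structure σ) (λ Hp → Rigid p Hp × Reach p H Hp)
  existence = let H* , rigid , steps = rigid-reachable p-prime H
              in  H* , rigid , H , Iso-refl H , steps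
  uniqueness : (H₁ H₂ : Structure σ) → Rigid p H₁ → Reach p H H₁ → Rigid p H₂ → Reach p H H₂ → Iso H₁ H₂
  uniqueness H₁ H₂ rigid₁ reach₁ rigid₂ reach₂ =
    mutual-embeddings⇒Iso (rigid-embeds p-prime rigid₁ reach₁ reach₂) (rigid-embeds p-prime rigid₂ reach₂ reach₁)
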